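{- Let $d, r$ be integers with $1 \leq d < r$. There is a graceful permutation of length $r$ whose sequence of absolute differences starts with $d$ if and only if $(d,r) \notin \{(2,4),(2,5),(2,8)\}$.
   Context: A graceful permutation of length $r$ is an arrangement $(\alpha_1,\ldots,\alpha_r)$ of $\{1,2,\ldots,r\}$ such that the absolute differences $\beta_i = |\alpha_{i+1} - \alpha_i|$, $1 \leq i \leq r-1$, are pairwise distinct; $(\beta_1,\ldots,\beta_{r-1})$ is its sequence of absolute differences. -}

module Defs where

open import Data.Nat using (ℕ; zero; suc; ∣_-_∣)
open import Data.Fin using (Fin; toℕ)
open import Data.Fin.Permutation using (Permutation′; _⟨$⟩ʳ_)
open import Data.List using (List; []; _∷_; map; head)
open import Data.List.Relation.Unary.Unique.Propositional using (Unique)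
open import Data.Maybe using (Maybe; just)
open import Data.Product using (Σ; _×_)
open import Data.Sum using (_⊎_)
open import Relation.Binary.PropositionalEquality using (_≡_)
open import Data.List using (allFin)

-- The arrangement (α₁,…,α_r) of {1,…,r} given by a permutation π of Fin r:
-- α_{i+1} = π(i) + 1.
arrangement : {r : ℕ} → Permutation′ r → List ℕ
arrangement {r} π = map (λ i → suc (toℕ (π ⟨$⟩ʳ i))) (allFin r)

absDiffs : List ℕ → List ℕ
absDiffs [] = []
absDiffs (x ∷ []) = []
absDiffs (x ∷ y ∷ xs) = ∣ y - x ∣ ∷ absDiffs (y ∷ xs)

Graceful : {r : ℕ} → Permutation′ r → Set
Graceful π = Unique (absDiffs (arrangement π))

GracefulStartingWith : ℕ → ℕ → Set
GracefulStartingWith d r =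
  Σ (Permutation′ r) λ π → Graceful π × head (absDiffs (arrangement π)) ≡ just d

Exceptional : ℕ → ℕ → Set
Exceptional d r = (d ≡ 2 × r ≡ 4) ⊎ (d ≡ 2 × r ≡ 5) ⊎ (d ≡ 2 × r ≡ 8)

-- A graceful list of length n (distinct entries 1..n with distinct absolute differences) that ends
-- at e can be extended by t = s + e entries, e ∈ {s, s+1}: shift it up by s and append the zigzag
-- n+t, 1, n+t-1, 2, …  The new differences n, n+t-1, …, n+1 exceed the old ones, the extension ends
-- at e again (t even) or at its complement (t odd), and its reversal starts with difference n+1.
--
-- Seeds, graceful lists of length n from e + ⌊n/2⌋ to e (1 ≤ e ≤ ⌈n/2⌉), are built by strong
-- induction on n.  Reversed extensions of seeds of length d-1 and of their complements have first
-- difference d and realise the lengths d+1 … 2d-1 with end ⌊d/2⌋+1 up to complement; extensions of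
-- lengths 2⌊d/2⌋+1 and 2⌊d/2⌋+2 keep that end, so every larger length is reached except 2d and, for
-- even d, 2d+1 and 3d+2.  These get separate constructions, which exist unless d = 2, and for
-- (2,4), (2,5), (2,8) an exhaustive search rules out a graceful permutation.
module Submission where

open import Defs
open import Data.Bool.Base using (Bool; T; _∨_)
open import Data.Bool.ListAction using (all)
open import Data.Bool.Properties using (T-∨)
open import Data.Empty using (⊥)
open import Data.Fin.Base using (Fin; toℕ; fromℕ<; punchOut)
open import Data.Fin.Permutation using (Permutation′; permutation; _⟨$⟩ʳ_)
open import Data.Fin.Properties using (toℕ-fromℕ<; toℕ-injective; toℕ<n; punchOut-injective; injective⇒≤; any?)
  renaming (_≟_ to _≟ᶠ_)
open import Data.List.Base
  using (List; []; _∷_; _++_; [_]; map; length; head; last; reverse; lookup; allFin; applyUpTo; applyDownFrom)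
open import Data.List.Membership.Propositional using (_∈_)
open import Data.List.Membership.Propositional.Properties using (∈-lookup; ∈-applyUpTo⁺)
open import Data.List.Properties
  using ( length-++; length-map; length-reverse; length-tabulate; unfold-reverse; reverse-involutive; applyDownFrom-∷ʳ
        ; head-map; last-map; map-tabulate; tabulate-cong; tabulate-lookup; ++-assoc; ++-identityʳ )
open import Data.List.Relation.Binary.Disjoint.Propositional using (Disjoint)
open import Data.List.Relation.Binary.Permutation.Propositional using (↭-sym; ↭⇒↭ₛ)
open import Data.List.Relation.Binary.Permutation.Propositional.Properties using (All-resp-↭; ↭-reverse)
import Data.List.Relation.Binary.Permutation.Setoid.Properties as Permutationₛ
open import Data.List.Relation.Unary.All as All using (All; []; _∷_)
import Data.List.Relation.Unary.All.Properties as All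
open import Data.List.Relation.Unary.Unique.Propositional using (Unique; []; _∷_)
import Data.List.Relation.Unary.Unique.Propositional.Properties as Unique
open import Data.Maybe.Base using (just)
import Data.Maybe.Base as Maybe
import Data.Maybe.Relation.Unary.All as MaybeAll
open import Data.Nat.Base
  using (ℕ; zero; suc; _+_; _∸_; _≤_; _<_; z≤n; s≤s; s≤s⁻¹; z<s; pred; ∣_-_∣; ⌊_/2⌋; ⌈_/2⌉)
open import Data.Nat.Induction using (<-rec)
open import Data.Nat.Properties
open import Data.Nat.Tactic.RingSolver using (solve-∀)
open import Data.List.Relation.Unary.Unique.DecPropositional _≟_ using (unique?)
open import Data.Product.Base using (Σ-syntax; ∃; _×_; _,_; proj₁; proj₂)
import Data.Product.Base as Product
open import Data.Sum.Base using (_⊎_; inj₁; inj₂)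
import Data.Sum.Base as Sum
open import Function.Base using (_∘′_)
open import Function.Bundles using (_⇔_; mk⇔; Equivalence; Injection)
open import Function.Definitions using (Injective)
open import Function.Properties.Inverse using (↔⇒↣)
open import Relation.Binary.Definitions using (tri<; tri≈; tri>)
open import Relation.Binary.PropositionalEquality hiding ([_])
open import Relation.Nullary using (¬_; contradiction; yes; no; Dec; _×-dec_)
open import Relation.Nullary.Decidable using (True; toWitness; isNo; toWitnessFalse)
open import Relation.Unary using (Decidable)

last-++ : ∀ {A : Set} (xs : List A) y ys → last (xs ++ y ∷ ys) ≡ last (y ∷ ys)
last-++ []            y ys = refl
last-++ (x ∷ [])      y ys = refl
last-++ (x ∷ x′ ∷ xs) y ys = last-++ (x′ ∷ xs) y ys

head-++ : ∀ {A : Set} {a : A} xs ys → head xs ≡ just a → head (xs ++ ys) ≡ just a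
head-++ (x ∷ xs) ys p = p

last-reverse : ∀ {A : Set} (xs : List A) → last (reverse xs) ≡ head xs
last-reverse []       = refl
last-reverse (x ∷ xs) = trans (cong last (unfold-reverse x xs)) (last-++ (reverse xs) x [])

head-reverse : ∀ {A : Set} (xs : List A) → head (reverse xs) ≡ last xs
head-reverse xs = trans (sym (last-reverse (reverse xs))) (cong last (reverse-involutive xs))

last-applyDownFrom : ∀ {A : Set} (f : ℕ → A) n → last (applyDownFrom f (suc n)) ≡ just (f 0)
last-applyDownFrom f n =
  trans (cong last (sym (applyDownFrom-∷ʳ f n))) (last-++ (applyDownFrom (λ i → f (suc i)) n) (f 0) [])

All-reverse : ∀ {P : ℕ → Set} {xs} → All P xs → All P (reverse xs)
All-reverse {xs = xs} = All-resp-↭ (↭-sym (↭-reverse xs))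

Unique-reverse : ∀ {xs : List ℕ} → Unique xs → Unique (reverse xs)
Unique-reverse {xs} = Permutationₛ.Unique-resp-↭ (setoid ℕ) (↭⇒↭ₛ (↭-sym (↭-reverse xs)))

Unique-++⁻ˡ : ∀ (xs : List ℕ) {ys} → Unique (xs ++ ys) → Unique xs
Unique-++⁻ˡ []       _             = []
Unique-++⁻ˡ (x ∷ xs) (x∉ ∷ unique) = All.++⁻ˡ xs x∉ ∷ Unique-++⁻ˡ xs unique

Unique-map-on : ∀ {P : ℕ → Set} (f : ℕ → ℕ) {xs} → (∀ {x y} → P x → P y → f x ≡ f y → x ≡ y) →
                All P xs → Unique xs → Unique (map f xs)
Unique-map-on f inj []         []           = []
Unique-map-on f inj (px ∷ pxs) (x∉xs ∷ uxs) =
  All.map⁺ (All.zipWith (λ (py , x≢y) fx≡fy → x≢y (inj px py fx≡fy)) (pxs , x∉xs)) ∷ Unique-map-on f inj pxs uxs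

Unique-lookup-injective : ∀ {xs : List ℕ} → Unique xs → ∀ {i j} → lookup xs i ≡ lookup xs j → i ≡ j
Unique-lookup-injective {x ∷ xs} _            {Fin.zero}  {Fin.zero}  _  = refl
Unique-lookup-injective {x ∷ xs} (x∉xs ∷ _)   {Fin.zero}  {Fin.suc j} x≡ = contradiction x≡ (All.lookup x∉xs (∈-lookup j))
Unique-lookup-injective {x ∷ xs} (x∉xs ∷ _)   {Fin.suc i} {Fin.zero}  ≡x = contradiction (sym ≡x) (All.lookup x∉xs (∈-lookup i))
Unique-lookup-injective {x ∷ xs} (_ ∷ unique) {Fin.suc i} {Fin.suc j} eq = cong Fin.suc (Unique-lookup-injective unique eq)

disjoint-by : ∀ {P Q : ℕ → Set} {xs ys} → (∀ {v} → P v → Q v → ⊥) → All P xs → All Q ys → Disjoint xs ys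
disjoint-by separate pxs qys (v∈xs , v∈ys) = separate (All.lookup pxs v∈xs) (All.lookup qys v∈ys)

m≡n+o⇒m∸o≡n : ∀ {m n o} → m ≡ n + o → m ∸ o ≡ n
m≡n+o⇒m∸o≡n {n = n} {o} refl = m+n∸n≡m n o

∣m-n+m∣≡n : ∀ m n → ∣ m - n + m ∣ ≡ n
∣m-n+m∣≡n m n = trans (cong (∣ m -_∣) (+-comm n m)) (∣m-m+n∣≡n m n)

∣-∣-reflect : ∀ {N x y} → x ≤ N → y ≤ N → ∣ N ∸ x - N ∸ y ∣ ≡ ∣ x - y ∣
∣-∣-reflect {N} {x} {y} x≤N y≤N = begin
  ∣ N ∸ x - N ∸ y ∣                       ≡⟨ sym (∣m+n-m+o∣≡∣n-o∣ (x + y) (N ∸ x) (N ∸ y)) ⟩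
  ∣ x + y + (N ∸ x) - x + y + (N ∸ y) ∣   ≡⟨ cong₂ ∣_-_∣ (regroup x y (N ∸ x)) (+-assoc x y (N ∸ y)) ⟩
  ∣ x + (N ∸ x) + y - x + (y + (N ∸ y)) ∣ ≡⟨ cong₂ (λ a b → ∣ a + y - x + b ∣) (m+[n∸m]≡n x≤N) (m+[n∸m]≡n y≤N) ⟩
  ∣ N + y - x + N ∣                       ≡⟨ cong (λ a → ∣ N + y - a ∣) (+-comm x N) ⟩
  ∣ N + y - N + x ∣                       ≡⟨ ∣m+n-m+o∣≡∣n-o∣ N y x ⟩
  ∣ y - x ∣                               ≡⟨ ∣-∣-comm y x ⟩
  ∣ x - y ∣                               ∎
  where
    open ≡-Reasoning
    regroup : ∀ x y z → x + y + z ≡ x + z + y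
    regroup = solve-∀

data Parity : ℕ → Set where
  even : ∀ k → Parity (k + k)
  odd  : ∀ k → Parity (suc (k + k))

parity : ∀ n → Parity n
parity zero          = even 0
parity (suc zero)    = odd 0
parity (suc (suc n)) with parity n
... | even k = subst Parity (cong suc (+-suc k k)) (even (suc k))
... | odd  k = subst Parity (cong (suc ∘′ suc) (+-suc k k)) (odd (suc k))

⌈n/2⌉≡⌊n/2⌋⊎⌈n/2⌉≡1+⌊n/2⌋ : ∀ n → ⌈ n /2⌉ ≡ ⌊ n /2⌋ ⊎ ⌈ n /2⌉ ≡ suc ⌊ n /2⌋
⌈n/2⌉≡⌊n/2⌋⊎⌈n/2⌉≡1+⌊n/2⌋ zero          = inj₁ refl
⌈n/2⌉≡⌊n/2⌋⊎⌈n/2⌉≡1+⌊n/2⌋ (suc zero)    = inj₂ refl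
⌈n/2⌉≡⌊n/2⌋⊎⌈n/2⌉≡1+⌊n/2⌋ (suc (suc n)) =
  Sum.map (cong suc) (cong suc) (⌈n/2⌉≡⌊n/2⌋⊎⌈n/2⌉≡1+⌊n/2⌋ n)

⌊e+s/2⌋≡s×⌈e+s/2⌉≡e : ∀ {s e} → e ≡ s ⊎ e ≡ suc s → ⌊ e + s /2⌋ ≡ s × ⌈ e + s /2⌉ ≡ e
⌊e+s/2⌋≡s×⌈e+s/2⌉≡e {s} (inj₁ refl) = sym (n≡⌊n+n/2⌋ s) , sym (n≡⌈n+n/2⌉ s)
⌊e+s/2⌋≡s×⌈e+s/2⌉≡e {s} (inj₂ refl) = sym (n≡⌈n+n/2⌉ s) , cong suc (sym (n≡⌊n+n/2⌋ s))

⌊m+[n+n]/2⌋≡⌊m/2⌋+n : ∀ m n → ⌊ m + (n + n) /2⌋ ≡ ⌊ m /2⌋ + n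
⌊m+[n+n]/2⌋≡⌊m/2⌋+n m zero    = trans (cong ⌊_/2⌋ (+-identityʳ m)) (sym (+-identityʳ ⌊ m /2⌋))
⌊m+[n+n]/2⌋≡⌊m/2⌋+n m (suc n) = begin
  ⌊ m + (suc n + suc n) /2⌋  ≡⟨ cong ⌊_/2⌋ (regroup m n) ⟩
  suc ⌊ m + (n + n) /2⌋      ≡⟨ cong suc (⌊m+[n+n]/2⌋≡⌊m/2⌋+n m n) ⟩
  suc (⌊ m /2⌋ + n)          ≡⟨ sym (+-suc ⌊ m /2⌋ n) ⟩
  ⌊ m /2⌋ + suc n            ∎
  where
    open ≡-Reasoning
    regroup : ∀ m n → m + (suc n + suc n) ≡ suc (suc (m + (n + n)))
    regroup = solve-∀

⌈n/2⌉≡1+2s⇒⌊⌊n/2⌋/2⌋≡s : ∀ n s → ⌈ n /2⌉ ≡ suc (s + s) → ⌊ ⌊ n /2⌋ /2⌋ ≡ s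
⌈n/2⌉≡1+2s⇒⌊⌊n/2⌋/2⌋≡s n s c≡ with ⌈n/2⌉≡⌊n/2⌋⊎⌈n/2⌉≡1+⌊n/2⌋ n
... | inj₁ c≡f   = trans (cong ⌊_/2⌋ (trans (sym c≡f) c≡)) (sym (n≡⌈n+n/2⌉ s))
... | inj₂ c≡1+f = trans (cong ⌊_/2⌋ (suc-injective (trans (sym c≡1+f) c≡))) (sym (n≡⌊n+n/2⌋ s))

InRange : ℕ → ℕ → Set
InRange n x = 1 ≤ x × x ≤ n

absDiffs-++ : ∀ {z} xs y ys → last xs ≡ just z → absDiffs (xs ++ y ∷ ys) ≡ absDiffs xs ++ ∣ y - z ∣ ∷ absDiffs (y ∷ ys)
absDiffs-++ (x ∷ [])      y ys refl = refl
absDiffs-++ (x ∷ x′ ∷ xs) y ys eq   = cong (∣ x′ - x ∣ ∷_) (absDiffs-++ (x′ ∷ xs) y ys eq)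

absDiffs-++-prefix : ∀ xs ys → ∃ λ zs → absDiffs (xs ++ ys) ≡ absDiffs xs ++ zs
absDiffs-++-prefix []            ys = absDiffs ys , refl
absDiffs-++-prefix (x ∷ [])      ys = absDiffs (x ∷ ys) , refl
absDiffs-++-prefix (x ∷ x′ ∷ xs) ys = Product.map₂ (cong (∣ x′ - x ∣ ∷_)) (absDiffs-++-prefix (x′ ∷ xs) ys)

absDiffs-shift : ∀ s xs → absDiffs (map (s +_) xs) ≡ absDiffs xs
absDiffs-shift s []           = refl
absDiffs-shift s (x ∷ [])     = refl
absDiffs-shift s (x ∷ y ∷ xs) = cong₂ _∷_ (∣m+n-m+o∣≡∣n-o∣ s y x) (absDiffs-shift s (y ∷ xs))

absDiffs-reflect : ∀ N xs → All (_≤ N) xs → absDiffs (map (N ∸_) xs) ≡ absDiffs xs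
absDiffs-reflect N []           _                  = refl
absDiffs-reflect N (x ∷ [])     _                  = refl
absDiffs-reflect N (x ∷ y ∷ xs) (x≤N ∷ y≤N ∷ xs≤N) =
  cong₂ _∷_ (∣-∣-reflect y≤N x≤N) (absDiffs-reflect N (y ∷ xs) (y≤N ∷ xs≤N))

absDiffs-reverse : ∀ xs → absDiffs (reverse xs) ≡ reverse (absDiffs xs)
absDiffs-reverse []           = refl
absDiffs-reverse (x ∷ [])     = refl
absDiffs-reverse (x ∷ y ∷ xs) = begin
  absDiffs (reverse (x ∷ y ∷ xs))              ≡⟨ cong absDiffs (unfold-reverse x (y ∷ xs)) ⟩
  absDiffs (reverse (y ∷ xs) ++ [ x ])         ≡⟨ absDiffs-++ (reverse (y ∷ xs)) x [] (last-reverse (y ∷ xs)) ⟩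
  absDiffs (reverse (y ∷ xs)) ++ [ ∣ x - y ∣ ]  ≡⟨ cong₂ (λ ds d → ds ++ [ d ]) (absDiffs-reverse (y ∷ xs)) (∣-∣-comm x y) ⟩
  reverse (absDiffs (y ∷ xs)) ++ [ ∣ y - x ∣ ]  ≡⟨ sym (unfold-reverse ∣ y - x ∣ (absDiffs (y ∷ xs))) ⟩
  reverse (absDiffs (x ∷ y ∷ xs))              ∎
  where open ≡-Reasoning

absDiffs-< : ∀ {n} xs → All (InRange n) xs → All (_< n) (absDiffs xs)
absDiffs-< []           _ = []
absDiffs-< (x ∷ [])     _ = []
absDiffs-< (suc x ∷ suc y ∷ xs) ((_ , x<n) ∷ (1≤y , y<n) ∷ rest) =
  ≤-<-trans (∣m-n∣≤m⊔n y x) (⊔-lub y<n x<n) ∷ absDiffs-< (suc y ∷ xs) ((1≤y , y<n) ∷ rest)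

-- Zigzags

-- zigzag↓ hi lo t = hi, lo, hi-1, lo+1, …  and  zigzag↑ hi lo t = lo, hi-1, lo+1, hi-2, …  (t entries);
-- the bound hi of zigzag↑ is exclusive.
mutual
  zigzag↓ : ℕ → ℕ → ℕ → List ℕ
  zigzag↓ hi lo zero    = []
  zigzag↓ hi lo (suc t) = hi ∷ zigzag↑ hi lo t

  zigzag↑ : ℕ → ℕ → ℕ → List ℕ
  zigzag↑ hi lo zero    = []
  zigzag↑ hi lo (suc t) = lo ∷ zigzag↓ (pred hi) (suc lo) t

mutual
  length-zigzag↓ : ∀ hi lo t → length (zigzag↓ hi lo t) ≡ t
  length-zigzag↓ hi lo zero    = refl
  length-zigzag↓ hi lo (suc t) = cong suc (length-zigzag↑ hi lo t)

  length-zigzag↑ : ∀ hi lo t → length (zigzag↑ hi lo t) ≡ t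
  length-zigzag↑ hi lo zero    = refl
  length-zigzag↑ hi lo (suc t) = cong suc (length-zigzag↓ (pred hi) (suc lo) t)

mutual
  zigzag↓-bounds : ∀ hi lo t → t + lo ≤ suc hi → All (λ x → lo ≤ x × x ≤ hi) (zigzag↓ hi lo t)
  zigzag↓-bounds hi lo zero    _  = []
  zigzag↓-bounds hi lo (suc t) le =
    (≤-trans (m≤n+m lo t) (s≤s⁻¹ le) , ≤-refl) ∷
    All.map (λ (lo≤x , x<hi) → lo≤x , <⇒≤ x<hi) (zigzag↑-bounds hi lo t (s≤s⁻¹ le))

  zigzag↑-bounds : ∀ hi lo t → t + lo ≤ hi → All (λ x → lo ≤ x × x < hi) (zigzag↑ hi lo t)
  zigzag↑-bounds hi       lo zero    _  = []
  zigzag↑-bounds (suc hi) lo (suc t) le =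
    (≤-refl , s≤s (≤-trans (m≤n+m lo t) (s≤s⁻¹ le))) ∷
    All.map (λ (lo<x , x≤hi) → <⇒≤ lo<x , s≤s x≤hi) (zigzag↓-bounds hi (suc lo) t (≤-trans (≤-reflexive (+-suc t lo)) le))

mutual
  zigzag↓-distinct : ∀ hi lo t → t + lo ≤ suc hi → Unique (zigzag↓ hi lo t)
  zigzag↓-distinct hi lo zero    _  = []
  zigzag↓-distinct hi lo (suc t) le =
    All.map (λ (_ , x<hi) → >⇒≢ x<hi) (zigzag↑-bounds hi lo t (s≤s⁻¹ le)) ∷ zigzag↑-distinct hi lo t (s≤s⁻¹ le)

  zigzag↑-distinct : ∀ hi lo t → t + lo ≤ hi → Unique (zigzag↑ hi lo t)
  zigzag↑-distinct hi       lo zero    _  = []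
  zigzag↑-distinct (suc hi) lo (suc t) le =
    All.map (λ (lo<x , _) → <⇒≢ lo<x) (zigzag↓-bounds hi (suc lo) t le′) ∷ zigzag↓-distinct hi (suc lo) t le′
    where le′ = ≤-trans (≤-reflexive (+-suc t lo)) le

mutual
  zigzag↓-gap : ∀ hi lo t → All (λ x → x < lo + ⌊ t /2⌋ ⊎ hi < x + ⌈ t /2⌉) (zigzag↓ hi lo t)
  zigzag↓-gap hi lo zero    = []
  zigzag↓-gap hi lo (suc t) =
    inj₂ (m<m+n hi z<s) ∷
    All.map (Sum.map₂ (λ high → ≤-trans (s≤s high) (≤-reflexive (sym (+-suc _ ⌊ t /2⌋))))) (zigzag↑-gap hi lo t)

  zigzag↑-gap : ∀ hi lo t → All (λ x → x < lo + ⌈ t /2⌉ ⊎ hi ≤ x + ⌊ t /2⌋) (zigzag↑ hi lo t)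
  zigzag↑-gap hi lo zero    = []
  zigzag↑-gap hi lo (suc t) =
    inj₁ (m<m+n lo z<s) ∷
    All.map (Sum.map (λ low → ≤-trans low (≤-reflexive (sym (+-suc lo ⌊ t /2⌋)))) (pred<⇒≤ hi)) (zigzag↓-gap (pred hi) (suc lo) t)
    where
      pred<⇒≤ : ∀ m {n} → pred m < n → m ≤ n
      pred<⇒≤ zero    _   = z≤n
      pred<⇒≤ (suc m) m<n = m<n

mutual
  zigzag↓-diffs : ∀ c lo t → absDiffs (zigzag↓ (t + c + lo) lo (suc t)) ≡ applyDownFrom (λ i → suc (i + c)) t
  zigzag↓-diffs c lo zero    = refl
  zigzag↓-diffs c lo (suc t) = cong₂ _∷_ (∣m-n+m∣≡n lo (suc (t + c))) (zigzag↑-diffs c lo t)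

  zigzag↑-diffs : ∀ c lo t → absDiffs (zigzag↑ (suc (t + c + lo)) lo (suc t)) ≡ applyDownFrom (λ i → suc (i + c)) t
  zigzag↑-diffs c lo zero    = refl
  zigzag↑-diffs c lo (suc t) = cong₂ _∷_
    (trans (∣-∣-comm (suc (t + c) + lo) lo) (∣m-n+m∣≡n lo (suc (t + c))))
    (subst (λ hi → absDiffs (zigzag↓ hi (suc lo) (suc t)) ≡ applyDownFrom (λ i → suc (i + c)) t)
           (+-suc (t + c) lo) (zigzag↓-diffs c (suc lo) t))

last-zigzag↓-even : ∀ e hi lo → last (zigzag↓ hi lo (suc e + suc e)) ≡ just (e + lo)
last-zigzag↓-even zero    hi lo = refl
last-zigzag↓-even (suc e) hi lo rewrite +-suc e (suc e) =
  trans (last-zigzag↓-even e (pred hi) (suc lo)) (cong just (+-suc e lo))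

last-zigzag↓-odd : ∀ s hi lo → last (zigzag↓ hi lo (suc (s + s))) ≡ just (hi ∸ s)
last-zigzag↓-odd zero    hi       lo = refl
last-zigzag↓-odd (suc s) zero     lo rewrite +-suc s s =
  trans (last-zigzag↓-odd s zero (suc lo)) (cong just (0∸n≡0 s))
last-zigzag↓-odd (suc s) (suc hi) lo rewrite +-suc s s = last-zigzag↓-odd s hi (suc lo)

-- Graceful lists and extensions

record GracefulList (n : ℕ) : Set where
  field
    elems          : List ℕ
    length-elems   : length elems ≡ n
    elems-in-range : All (InRange n) elems
    elems-distinct : Unique elems
    diffs-distinct : Unique (absDiffs elems)
open GracefulList public

module _ {n : ℕ} where

  StartsAt EndsAt FirstDiff : ℕ → GracefulList n → Set
  StartsAt a g  = head (elems g) ≡ just a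
  EndsAt b g    = last (elems g) ≡ just b
  FirstDiff d g = head (absDiffs (elems g)) ≡ just d

StartingWith : ℕ → ℕ → Set
StartingWith d L = Σ[ g ∈ GracefulList L ] FirstDiff d g

inRange? : ∀ n x → Dec (InRange n x)
inRange? n x = (1 ≤? x) ×-dec (x ≤? n)

fromList : ∀ n xs → {True (length xs ≟ n)} → {True (All.all? (inRange? n) xs)} →
           {True (unique? xs)} → {True (unique? (absDiffs xs))} → GracefulList n
fromList n xs {len} {range} {distinct} {graceful} = record
  { elems = xs ; length-elems = toWitness len ; elems-in-range = toWitness range
  ; elems-distinct = toWitness distinct ; diffs-distinct = toWitness graceful }

module _ {n : ℕ} (g : GracefulList n) where

  private
    elems-≤ : All (_≤ suc n) (elems g)
    elems-≤ = All.map (λ (_ , x≤n) → m≤n⇒m≤1+n x≤n) (elems-in-range g)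

  complement : GracefulList n
  complement = record
    { elems          = map (suc n ∸_) (elems g)
    ; length-elems   = trans (length-map _ (elems g)) (length-elems g)
    ; elems-in-range = All.map⁺ (All.map (λ (1≤x , x≤n) → m<n⇒0<n∸m (s≤s x≤n) , ∸-monoʳ-≤ (suc n) 1≤x) (elems-in-range g))
    ; elems-distinct = Unique-map-on (suc n ∸_) (λ (_ , x≤n) (_ , y≤n) → ∸-cancelˡ-≡ (m≤n⇒m≤1+n x≤n) (m≤n⇒m≤1+n y≤n))
                                     (elems-in-range g) (elems-distinct g)
    ; diffs-distinct = subst Unique (sym (absDiffs-reflect (suc n) (elems g) elems-≤)) (diffs-distinct g)
    }

  complement-firstDiff : ∀ {d} → FirstDiff d g → FirstDiff d complement
  complement-firstDiff = trans (cong head (absDiffs-reflect (suc n) (elems g) elems-≤))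

  complement-starts : ∀ {a} → StartsAt a g → StartsAt (suc n ∸ a) complement
  complement-starts p = trans (head-map (elems g)) (cong (Maybe.map (suc n ∸_)) p)

  complement-ends : ∀ {b} → EndsAt b g → EndsAt (suc n ∸ b) complement
  complement-ends p = trans (last-map (suc n ∸_) (elems g)) (cong (Maybe.map (suc n ∸_)) p)

  reversal : GracefulList n
  reversal = record
    { elems          = reverse (elems g)
    ; length-elems   = trans (length-reverse (elems g)) (length-elems g)
    ; elems-in-range = All-reverse (elems-in-range g)
    ; elems-distinct = Unique-reverse (elems-distinct g)
    ; diffs-distinct = subst Unique (sym (absDiffs-reverse (elems g))) (Unique-reverse (diffs-distinct g))
    }

  reversal-starts : ∀ {b} → EndsAt b g → StartsAt b reversal
  reversal-starts = trans (head-reverse (elems g))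

  reversal-ends : ∀ {a} → StartsAt a g → EndsAt a reversal
  reversal-ends = trans (last-reverse (elems g))

  reversal-firstDiff : ∀ {d} → last (absDiffs (elems g)) ≡ just d → FirstDiff d reversal
  reversal-firstDiff = trans (trans (cong head (absDiffs-reverse (elems g))) (head-reverse (absDiffs (elems g))))

module Extension {n : ℕ} (g : GracefulList n) (e s : ℕ) (halving : suc e ≡ s ⊎ suc e ≡ suc s) (ends : EndsAt (suc e) g) where

  private
    t hi : ℕ
    t  = suc (e + s)
    hi = n + t

    downs : List ℕ
    downs = applyDownFrom (λ i → suc (i + n)) (e + s)

  zigzag : List ℕ
  zigzag = zigzag↓ hi 1 t

  extended : List ℕ
  extended = map (s +_) (elems g) ++ zigzag

  extended-diffs : absDiffs extended ≡ absDiffs (elems g) ++ n ∷ downs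
  extended-diffs = begin
    absDiffs extended
      ≡⟨ absDiffs-++ (map (s +_) (elems g)) hi _ (trans (last-map (s +_) (elems g)) (cong (Maybe.map (s +_)) ends)) ⟩
    absDiffs (map (s +_) (elems g)) ++ ∣ hi - s + suc e ∣ ∷ absDiffs zigzag
      ≡⟨ cong₂ (λ ds d → ds ++ d ∷ absDiffs zigzag) (absDiffs-shift s (elems g)) junction ⟩
    absDiffs (elems g) ++ n ∷ absDiffs zigzag
      ≡⟨ cong (λ ds → absDiffs (elems g) ++ n ∷ ds) zigzag-diffs ⟩
    absDiffs (elems g) ++ n ∷ downs
      ∎
    where
      open ≡-Reasoning
      junction : ∣ hi - s + suc e ∣ ≡ n
      junction = trans (cong (λ m → ∣ hi - m ∣) (trans (+-suc s e) (cong suc (+-comm s e))))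
                       (trans (∣-∣-comm hi t) (∣m-n+m∣≡n t n))
      regroup : ∀ k n → k + n + 1 ≡ n + suc k
      regroup = solve-∀
      zigzag-diffs : absDiffs zigzag ≡ downs
      zigzag-diffs = subst (λ h → absDiffs (zigzag↓ h 1 t) ≡ downs) (regroup (e + s) n) (zigzag↓-diffs n 1 (e + s))

  private
    halves : ⌊ t /2⌋ ≡ s × ⌈ t /2⌉ ≡ suc e
    halves = ⌊e+s/2⌋≡s×⌈e+s/2⌉≡e halving

    shifted-range : All (λ y → s < y × y ≤ s + n) (map (s +_) (elems g))
    shifted-range = All.map⁺ (All.map (λ (1≤x , x≤n) → m<m+n s 1≤x , +-monoʳ-≤ s x≤n) (elems-in-range g))

    zigzag-fits : t + 1 ≤ suc hi
    zigzag-fits = ≤-trans (≤-reflexive (+-comm t 1)) (s≤s (m≤n+m t n))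

    separated : ∀ {y} → s < y × y ≤ s + n → y < 1 + ⌊ t /2⌋ ⊎ hi < y + ⌈ t /2⌉ → ⊥
    separated     (s<y , _)     (inj₁ y<1+s)    = <⇒≱ s<y (s≤s⁻¹ (subst (λ k → _ < 1 + k) (proj₁ halves) y<1+s))
    separated {y} (_   , y≤s+n) (inj₂ hi<y+e) =
      <⇒≱ (subst (λ k → hi < y + k) (proj₂ halves) hi<y+e) (≤-trans (+-monoˡ-≤ (suc e) y≤s+n) (≤-reflexive (regroup s n e)))
      where regroup : ∀ s n e → s + n + suc e ≡ n + suc (e + s)
            regroup = solve-∀

    downs-above : All (n <_) downs
    downs-above = All.applyDownFrom⁺₂ _ (e + s) (λ i → s≤s (m≤n+m n i))

    new-diffs-distinct : Unique (n ∷ downs)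
    new-diffs-distinct = All.map <⇒≢ downs-above ∷ Unique.applyDownFrom⁺₁ _ (e + s) (λ j<i _ → >⇒≢ (s≤s (+-monoˡ-< n j<i)))

  extension : GracefulList (n + t)
  extension = record
    { elems          = extended
    ; length-elems   = trans (length-++ (map (s +_) (elems g)))
                             (cong₂ _+_ (trans (length-map _ (elems g)) (length-elems g)) (length-zigzag↓ hi 1 t))
    ; elems-in-range = All.++⁺
        (All.map (λ (s<y , y≤s+n) → ≤-trans (s≤s z≤n) s<y , ≤-trans y≤s+n (≤-trans (≤-reflexive (+-comm s n)) (+-monoʳ-≤ n (m≤n+m s (suc e)))))
                 shifted-range)
        (zigzag↓-bounds hi 1 t zigzag-fits)
    ; elems-distinct = Unique.++⁺ (Unique.map⁺ (+-cancelˡ-≡ s _ _) (elems-distinct g)) (zigzag↓-distinct hi 1 t zigzag-fits)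
                                 (disjoint-by separated shifted-range (zigzag↓-gap hi 1 t))
    ; diffs-distinct = subst Unique (sym extended-diffs)
        (Unique.++⁺ (diffs-distinct g) new-diffs-distinct
                    (disjoint-by <⇒≱ (absDiffs-< (elems g) (elems-in-range g)) (≤-refl ∷ All.map <⇒≤ downs-above)))
    }

  extension-starts : ∀ {a} → StartsAt a g → StartsAt (s + a) extension
  extension-starts p = head-++ (map (s +_) (elems g)) zigzag (trans (head-map (elems g)) (cong (Maybe.map (s +_)) p))

  extension-firstDiff : ∀ {d} → FirstDiff d g → FirstDiff d extension
  extension-firstDiff p = trans (cong head extended-diffs) (head-++ (absDiffs (elems g)) _ p)

  extension-lastDiff : 1 ≤ e + s → last (absDiffs extended) ≡ just (suc n)
  extension-lastDiff 1≤e+s =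
    trans (cong last extended-diffs) (trans (last-++ (absDiffs (elems g)) n downs) (last-downs (e + s) 1≤e+s))
    where
      last-downs : ∀ k → 1 ≤ k → last (n ∷ applyDownFrom (λ i → suc (i + n)) k) ≡ just (suc n)
      last-downs (suc k) _ = last-applyDownFrom _ k

  extension-ends-zigzag : last extended ≡ last zigzag
  extension-ends-zigzag = last-++ (map (s +_) (elems g)) hi _

  reversed : GracefulList (n + t)
  reversed = reversal extension

  reversed-firstDiff : 1 ≤ e + s → FirstDiff (suc n) reversed
  reversed-firstDiff 1≤e+s = reversal-firstDiff extension (extension-lastDiff 1≤e+s)

  reversed-ends : ∀ {a} → StartsAt a g → EndsAt (s + a) reversed
  reversed-ends starts = reversal-ends extension (extension-starts starts)

extension-ends-even : ∀ {n m} (g : GracefulList n) (ends : EndsAt (suc m) g) →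
                      EndsAt (suc m) (Extension.extension g m (suc m) (inj₁ refl) ends)
extension-ends-even {n} {m} g ends =
  trans (Extension.extension-ends-zigzag g m (suc m) (inj₁ refl) ends)
        (trans (last-zigzag↓-even m (n + suc (m + suc m)) 1) (cong just (+-comm m 1)))

extension-ends-odd : ∀ {n m} (g : GracefulList n) (ends : EndsAt (suc m) g) →
                     EndsAt (n + suc m) (Extension.extension g m m (inj₂ refl) ends)
extension-ends-odd {n} {m} g ends =
  trans (Extension.extension-ends-zigzag g m m (inj₂ refl) ends)
        (trans (last-zigzag↓-odd m (n + suc (m + m)) 1) (cong just (m≡n+o⇒m∸o≡n (regroup n m))))
  where
    regroup : ∀ n m → n + suc (m + m) ≡ n + suc m + m
    regroup = solve-∀

-- Seeds

Seed : ℕ → ℕ → Set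
Seed n e = Σ[ g ∈ GracefulList n ] StartsAt (e + ⌊ n /2⌋) g × EndsAt e g

Seeds : ℕ → Set
Seeds n = ∀ e → 1 ≤ e → e ≤ ⌈ n /2⌉ → Seed n e

seed₁ : Seed 1 1
seed₁ = fromList 1 (1 ∷ []) , refl , refl

seed-grow : ∀ {n} e → Seed n (suc e) → Seed (n + (suc e + suc e)) (suc e)
seed-grow {n} e (g , starts , ends) =
  extension ,
  trans (extension-starts starts)
        (cong (λ h → just (suc e + h)) (sym (trans (⌊m+[n+n]/2⌋≡⌊m/2⌋+n n (suc e)) (+-comm ⌊ n /2⌋ (suc e))))) ,
  extension-ends-even g ends
  where open Extension g e (suc e) (inj₁ refl) ends

seed-mirror : ∀ {n e e′} → e + e′ ≡ suc ⌈ n /2⌉ → Seed n e → Seed n e′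
seed-mirror {n} {e} {e′} e+e′≡ (g , starts , ends) =
  reversal (complement g) ,
  reversal-starts (complement g) (trans (complement-ends g ends) (cong just (m≡n+o⇒m∸o≡n 1+n≡e′+f+e))) ,
  reversal-ends (complement g) (trans (complement-starts g starts) (cong just (m≡n+o⇒m∸o≡n (trans 1+n≡e′+f+e (regroup e′ f e)))))
  where
    f = ⌊ n /2⌋
    regroup : ∀ a b c → a + b + c ≡ a + (c + b)
    regroup = solve-∀
    1+n≡e′+f+e : suc n ≡ e′ + f + e
    1+n≡e′+f+e = begin
      suc n              ≡⟨ cong suc (sym (⌊n/2⌋+⌈n/2⌉≡n n)) ⟩
      suc (f + ⌈ n /2⌉)  ≡⟨ sym (+-suc f ⌈ n /2⌉) ⟩
      f + suc ⌈ n /2⌉    ≡⟨ cong (f +_) (sym e+e′≡) ⟩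
      f + (e + e′)       ≡⟨ rotate f e e′ ⟩
      e′ + f + e         ∎
      where
        open ≡-Reasoning
        rotate : ∀ a b c → a + (b + c) ≡ c + a + b
        rotate = solve-∀

-- Reversing a seed of length m from 1 gives an end ⌊m/2⌋ + 1 = s + 1, which is what an odd extension needs.
seed-from-half : ∀ {m} s → ⌊ m /2⌋ ≡ s → Seed m 1 → Seed (m + suc (s + s)) (suc s)
seed-from-half {m} s ⌊m/2⌋≡s (g , starts , ends) =
  complement extension ,
  trans (complement-starts extension (extension-starts (reversal-starts g ends)))
        (cong just (m≡n+o⇒m∸o≡n (trans (regroup₁ m s) (cong (λ k → suc s + k + (s + 1)) (sym ⌊N/2⌋≡m))))) ,
  trans (complement-ends extension (extension-ends-odd (reversal g) ends′)) (cong just (m≡n+o⇒m∸o≡n (regroup₂ m s)))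
  where
    ends′ : EndsAt (suc s) (reversal g)
    ends′ = reversal-ends g (trans starts (cong (λ k → just (suc k)) ⌊m/2⌋≡s))
    open Extension (reversal g) s s (inj₂ refl) ends′
    regroup₁ : ∀ m s → suc (m + suc (s + s)) ≡ suc s + m + (s + 1)
    regroup₁ = solve-∀
    regroup₂ : ∀ m s → suc (m + suc (s + s)) ≡ suc s + (m + suc s)
    regroup₂ = solve-∀
    ⌊N/2⌋≡m : ⌊ m + suc (s + s) /2⌋ ≡ m
    ⌊N/2⌋≡m = begin
      ⌊ m + suc (s + s) /2⌋  ≡⟨ cong ⌊_/2⌋ (+-suc m (s + s)) ⟩
      ⌊ suc m + (s + s) /2⌋  ≡⟨ ⌊m+[n+n]/2⌋≡⌊m/2⌋+n (suc m) s ⟩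
      ⌈ m /2⌉ + s            ≡⟨ cong (⌈ m /2⌉ +_) (sym ⌊m/2⌋≡s) ⟩
      ⌈ m /2⌉ + ⌊ m /2⌋      ≡⟨ +-comm ⌈ m /2⌉ ⌊ m /2⌋ ⟩
      ⌊ m /2⌋ + ⌈ m /2⌉      ≡⟨ ⌊n/2⌋+⌈n/2⌉≡n m ⟩
      m                      ∎
      where open ≡-Reasoning

seed-low : ∀ {n} → (∀ {m} → m < n → Seeds m) → ∀ e → 1 ≤ e → e + e ≤ ⌈ n /2⌉ → Seed n e
seed-low {n} rec (suc e) _ 2e≤c =
  subst (λ k → Seed k (suc e)) (m∸n+n≡m 2e≤n) (seed-grow e (rec n′<n (suc e) (s≤s z≤n) e<⌈n′/2⌉))
  where
    n′ = n ∸ (suc e + suc e)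
    2e≤n = ≤-trans 2e≤c (⌈n/2⌉≤n n)
    n′<n : n′ < n
    n′<n = ∸-monoʳ-< {o = 0} z<s 2e≤n
    e<⌈n′/2⌉ : suc e ≤ ⌈ n′ /2⌉
    e<⌈n′/2⌉ = +-cancelʳ-≤ (suc e) (suc e) ⌈ n′ /2⌉ (begin
      suc e + suc e              ≤⟨ 2e≤c ⟩
      ⌈ n /2⌉                    ≡⟨ cong ⌈_/2⌉ (sym (m∸n+n≡m 2e≤n)) ⟩
      ⌈ n′ + (suc e + suc e) /2⌉ ≡⟨ ⌊m+[n+n]/2⌋≡⌊m/2⌋+n (suc n′) (suc e) ⟩
      ⌈ n′ /2⌉ + suc e           ∎)
      where open ≤-Reasoning

seed-middle : ∀ k → (∀ {m} → m < suc (suc k) → Seeds m) → ∀ e → e + e ≡ suc ⌈ suc (suc k) /2⌉ → Seed (suc (suc k)) e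
seed-middle k rec (suc s) 2e≡c+1 =
  subst (λ n → Seed n (suc s)) (trans (cong (⌊ n /2⌋ +_) (sym c≡2s+1)) (⌊n/2⌋+⌈n/2⌉≡n n))
        (seed-from-half s (⌈n/2⌉≡1+2s⇒⌊⌊n/2⌋/2⌋≡s n s c≡2s+1) (rec (⌊n/2⌋<n (suc k)) 1 ≤-refl (s≤s z≤n)))
  where
    n = suc (suc k)
    c≡2s+1 : ⌈ n /2⌉ ≡ suc (s + s)
    c≡2s+1 = trans (sym (suc-injective 2e≡c+1)) (+-suc s s)

seed-high : ∀ {n} → (∀ {m} → m < n → Seeds m) → ∀ e → e ≤ ⌈ n /2⌉ → suc ⌈ n /2⌉ < e + e → Seed n e
seed-high {n} rec e e≤c c+1<2e = seed-mirror e′+e≡c+1 (seed-low rec e′ (m<n⇒0<n∸m (s≤s e≤c)) 2e′≤c)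
  where
    c = ⌈ n /2⌉
    e′ = suc c ∸ e
    e+e′≡c+1 : e + e′ ≡ suc c
    e+e′≡c+1 = m+[n∸m]≡n (m≤n⇒m≤1+n e≤c)
    e′+e≡c+1 : e′ + e ≡ suc c
    e′+e≡c+1 = trans (+-comm e′ e) e+e′≡c+1
    e′<e : e′ < e
    e′<e = +-cancelˡ-< e e′ e (subst (_< e + e) (sym e+e′≡c+1) c+1<2e)
    2e′≤c : e′ + e′ ≤ c
    2e′≤c = s≤s⁻¹ (≤-trans (+-monoʳ-< e′ e′<e) (≤-reflexive e′+e≡c+1))

seed : ∀ n → Seeds n
seed = <-rec Seeds grow
  where
    grow : ∀ n → (∀ {m} → m < n → Seeds m) → Seeds n
    grow zero            _   e             1≤e e≤0      = contradiction e≤0 (<⇒≱ 1≤e)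
    grow (suc zero)      _   (suc zero)    _   _        = seed₁
    grow (suc zero)      _   (suc (suc e)) _   (s≤s ())
    grow n@(suc (suc k)) rec e             1≤e e≤c with <-cmp (e + e) (suc ⌈ n /2⌉)
    ... | tri< 2e≤c _ _   = seed-low rec e 1≤e (s≤s⁻¹ 2e≤c)
    ... | tri≈ _ 2e≡c+1 _ = seed-middle k rec e 2e≡c+1
    ... | tri> _ _ c+1<2e = seed-high rec e e≤c c+1<2e

-- Covering all lengths

Anchored : ℕ → ℕ → ℕ → Set
Anchored d m L = Σ[ g ∈ GracefulList L ] FirstDiff d g × EndsAt m g

forget-end : ∀ {d m L} → Anchored d m L → StartingWith d L
forget-end (g , first , _) = g , first

anchored-mirror : ∀ {d m b L} (g : GracefulList L) → FirstDiff d g → EndsAt b g → m + b ≡ suc L → Anchored d m L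
anchored-mirror g first ends m+b≡ =
  complement g , complement-firstDiff g first , trans (complement-ends g ends) (cong just (m≡n+o⇒m∸o≡n (sym m+b≡)))

anchored-step-even : ∀ {d m L} → Anchored d (suc m) L → Anchored d (suc m) (L + (suc m + suc m))
anchored-step-even {m = m} (g , first , ends) = extension , extension-firstDiff first , extension-ends-even g ends
  where open Extension g m (suc m) (inj₁ refl) ends

anchored-step-odd : ∀ {d m L} → Anchored d (suc m) L → Anchored d (suc m) (L + suc (m + m))
anchored-step-odd {m = m} {L} (g , first , ends) =
  anchored-mirror extension (extension-firstDiff first) (extension-ends-odd g ends) (regroup m L)
  where
    open Extension g m m (inj₂ refl) ends
    regroup : ∀ m L → suc m + (L + suc m) ≡ suc (L + suc (m + m))
    regroup = solve-∀

Window : (ℕ → Set) → ℕ → ℕ → Set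
Window P a k = ∀ i → i < k → P (a + i)

module _ {P : ℕ → Set} {d : ℕ} (step : ∀ {L} → P L → P (L + d)) where

  window-layer : (∀ {L} → P L → P (L + suc d)) → ∀ {a k} → Window P a (suc k) → Window P (a + d) (suc (suc k))
  window-layer step′ {a} {k} window i i<k+2 with m≤n⇒m<n∨m≡n (s≤s⁻¹ i<k+2)
  ... | inj₁ i<k+1 = subst P (regroup a i d) (step (window i i<k+1))
    where regroup : ∀ a i d → a + i + d ≡ a + d + i
          regroup = solve-∀
  ... | inj₂ refl  = subst P (regroup a k d) (step′ (window k ≤-refl))
    where regroup : ∀ a k d → a + k + suc d ≡ a + d + suc k
          regroup = solve-∀

  window-periodic : 1 ≤ d → ∀ {a} → Window P a d → ∀ i → P (a + i)
  window-periodic 1≤d {a} window = <-rec (λ i → P (a + i)) periodic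
    where
      periodic : ∀ i → (∀ {j} → j < i → P (a + j)) → P (a + i)
      periodic i rec with i <? d
      ... | yes i<d = window i i<d
      ... | no  i≮d = subst P (trans (+-assoc a (i ∸ d) d) (cong (a +_) (m∸n+n≡m (≮⇒≥ i≮d))))
                              (step (rec (∸-monoʳ-< {o = 0} 1≤d (≮⇒≥ i≮d))))

window-then : ∀ {P : ℕ → Set} {a k} → Window P a k → (∀ i → P (a + k + i)) → ∀ i → P (a + i)
window-then {P} {a} {k} window rest i with i <? k
... | yes i<k = window i i<k
... | no  i≮k = subst P (trans (+-assoc a k (i ∸ k)) (cong (a +_) (m+[n∸m]≡n (≮⇒≥ i≮k)))) (rest (i ∸ k))

seed-window : ∀ n i → suc ⌈ i /2⌉ ≤ ⌈ n /2⌉ → Anchored (suc n) (suc ⌈ n /2⌉) (n + 2 + i)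
seed-window n i e≤c with seed n (suc ⌈ i /2⌉) (s≤s z≤n) e≤c
... | g , starts , ends =
  subst (Anchored (suc n) (suc ⌈ n /2⌉)) length≡
        (anchored-mirror reversed (reversed-firstDiff (≤-trans (s≤s z≤n) (m≤n+m (suc ⌊ i /2⌋) ⌈ i /2⌉))) (reversed-ends starts) end≡)
  where
    open Extension g ⌈ i /2⌉ (suc ⌊ i /2⌋) (Sum.map (cong suc) (cong suc) (⌈n/2⌉≡⌊n/2⌋⊎⌈n/2⌉≡1+⌊n/2⌋ i)) ends
    length≡ : n + suc (⌈ i /2⌉ + suc ⌊ i /2⌋) ≡ n + 2 + i
    length≡ = trans (regroup n ⌈ i /2⌉ ⌊ i /2⌋) (cong (λ k → n + 2 + k) (⌊n/2⌋+⌈n/2⌉≡n i))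
      where regroup : ∀ n c f → n + suc (c + suc f) ≡ n + 2 + (f + c)
            regroup = solve-∀
    end≡ : suc ⌈ n /2⌉ + (suc ⌊ i /2⌋ + (suc ⌈ i /2⌉ + ⌊ n /2⌋)) ≡ suc (n + suc (⌈ i /2⌉ + suc ⌊ i /2⌋))
    end≡ = trans (regroup ⌈ n /2⌉ ⌊ n /2⌋ ⌈ i /2⌉ ⌊ i /2⌋)
                 (cong (λ k → suc (k + suc (⌈ i /2⌉ + suc ⌊ i /2⌋))) (⌊n/2⌋+⌈n/2⌉≡n n))
      where regroup : ∀ c f C F → suc c + (suc F + (suc C + f)) ≡ suc (f + c + suc (C + suc F))
            regroup = solve-∀

seed-window-beyond : ∀ n s → 1 ≤ ⌊ n /2⌋ → suc ⌈ n /2⌉ ≡ s ⊎ suc ⌈ n /2⌉ ≡ suc s →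
                     Anchored (suc n) (s + (suc n ∸ (⌊ n /2⌋ + ⌊ n /2⌋))) (n + suc (⌈ n /2⌉ + s))
seed-window-beyond n s 1≤f halving with seed n ⌊ n /2⌋ 1≤f (⌊n/2⌋≤⌈n/2⌉ n)
... | g , starts , ends =
  reversed ,
  reversed-firstDiff (≤-trans 1≤f (≤-trans (⌊n/2⌋≤⌈n/2⌉ n) (m≤m+n ⌈ n /2⌉ s))) ,
  reversed-ends (complement-starts g starts)
  where
    ends′ : EndsAt (suc ⌈ n /2⌉) (complement g)
    ends′ = trans (complement-ends g ends)
                  (cong just (m≡n+o⇒m∸o≡n (cong suc (trans (sym (⌊n/2⌋+⌈n/2⌉≡n n)) (+-comm ⌊ n /2⌋ ⌈ n /2⌉)))))
    open Extension (complement g) ⌈ n /2⌉ s halving ends′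

EndingAtTwo : ℕ → Set
EndingAtTwo j = Σ[ g ∈ GracefulList (suc (j + j)) ] StartsAt j g × EndsAt 2 g

endingAtTwo-grow : ∀ {j} → EndingAtTwo j → EndingAtTwo (2 + j)
endingAtTwo-grow {j} (g , starts , ends) =
  subst (λ L → Σ[ g ∈ GracefulList L ] StartsAt (2 + j) g × EndsAt 2 g) (regroup j)
        (extension , extension-starts starts , extension-ends-even g ends)
  where
    open Extension g 1 2 (inj₁ refl) ends
    regroup : ∀ j → suc (j + j) + 4 ≡ suc (2 + j + (2 + j))
    regroup = solve-∀

endingAtTwo : ∀ j → 1 ≤ j → j ≢ 2 → EndingAtTwo j
endingAtTwo 1 _ _   = fromList 3 (1 ∷ 3 ∷ 2 ∷ []) , refl , refl
endingAtTwo 2 _ j≢2 = contradiction refl j≢2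
endingAtTwo 3 _ _   = endingAtTwo-grow (endingAtTwo 1 ≤-refl (λ ()))
endingAtTwo 4 _ _   = fromList 9 (4 ∷ 6 ∷ 5 ∷ 8 ∷ 1 ∷ 9 ∷ 3 ∷ 7 ∷ 2 ∷ []) , refl , refl
endingAtTwo (suc (suc (suc (suc (suc j))))) _ _ = endingAtTwo-grow (endingAtTwo (suc (suc (suc j))) (s≤s z≤n) (λ ()))

-- Stands in for EvenDifference.tripled 2, which would need endingAtTwo 2, a list starting and ending at 2.
six-twenty : StartingWith 6 20
six-twenty = fromList 20 (7 ∷ 13 ∷ 6 ∷ 14 ∷ 9 ∷ 12 ∷ 8 ∷ 10 ∷ 11 ∷ 20 ∷ 1 ∷ 19 ∷ 2 ∷ 18 ∷ 3 ∷ 17 ∷ 4 ∷ 16 ∷ 5 ∷ 15 ∷ []) , refl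

unit-lengths : ∀ i → StartingWith 1 (2 + i)
unit-lengths i = forget-end (window-periodic {P = Anchored 1 1} anchored-step-odd ≤-refl
  (λ { zero _ → fromList 2 (2 ∷ 1 ∷ []) , refl , refl ; (suc _) (s≤s ()) }) i)

-- First difference D = n + 1 = 2c + 1: the window gives the lengths D+1 … 2D-1, `doubled` the length 2D,
-- and `anchored` every length from 2D+1 on.
module OddDifference (c′ : ℕ) where

  c n : ℕ
  c = suc c′
  n = c + c

  P : ℕ → Set
  P = Anchored (suc n) (suc c)

  ⌈n/2⌉≡c : ⌈ n /2⌉ ≡ c
  ⌈n/2⌉≡c = sym (n≡⌈n+n/2⌉ c)

  ⌊n/2⌋≡c : ⌊ n /2⌋ ≡ c
  ⌊n/2⌋≡c = sym (n≡⌊n+n/2⌋ c)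

  step : ∀ {L} → P L → P (L + suc n)
  step = anchored-step-odd

  step′ : ∀ {L} → P L → P (L + suc (suc n))
  step′ {L} p = subst P (cong (λ k → L + suc k) (+-suc c c)) (anchored-step-even p)

  beyond : ∀ s → suc c ≡ s ⊎ suc c ≡ suc s → Anchored (suc n) (s + 1) (n + suc (c + s))
  beyond s halving = subst₂ (λ k b → Anchored (suc n) (s + b) (n + suc (k + s)))
    ⌈n/2⌉≡c (trans (cong (λ f → suc n ∸ (f + f)) ⌊n/2⌋≡c) (m+n∸n≡m 1 n))
    (seed-window-beyond n s (subst (1 ≤_) (sym ⌊n/2⌋≡c) (s≤s z≤n)) (subst (λ k → suc k ≡ s ⊎ suc k ≡ suc s) (sym ⌈n/2⌉≡c) halving))

  window : Window P (n + 2) n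
  window i i<n with m≤n⇒m<n∨m≡n i<n
  ... | inj₁ i+1<n = subst (λ m → Anchored (suc n) (suc m) (n + 2 + i)) ⌈n/2⌉≡c (seed-window n i (⌈n/2⌉-mono i+1<n))
  ... | inj₂ i+1≡n = subst₂ (Anchored (suc n)) (+-comm c 1) (trans (cong (λ k → n + suc k) (sym i+1≡n)) (sym (+-assoc n 2 i)))
                            (beyond c (inj₂ refl))

  doubled : StartingWith (suc n) (n + 2 + n + 0)
  doubled = subst (StartingWith (suc n)) (regroup c) (forget-end (beyond (suc c) (inj₁ refl)))
    where regroup : ∀ c → c + c + suc (c + suc c) ≡ c + c + 2 + (c + c) + 0
          regroup = solve-∀

  anchored : ∀ i → P (n + 2 + suc n + i)
  anchored = window-periodic {P = P} step (s≤s z≤n) (window-layer {P = P} step step′ window)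

  lengths : ∀ i → StartingWith (suc n) (n + 2 + i)
  lengths =
    window-then {P = StartingWith (suc n)} (λ i i<n → forget-end (window i i<n))
    (window-then {P = StartingWith (suc n)} (λ { zero _ → doubled ; (suc _) (s≤s ()) })
    (λ i → subst (StartingWith (suc n)) (regroup n i) (forget-end (anchored i))))
    where regroup : ∀ n i → n + 2 + suc n + i ≡ n + 2 + n + 1 + i
          regroup = solve-∀

-- First difference D = n + 1 = 2f + 2: the window gives D+1 … 2D-1, `doubled` 2D and 2D+1, `layer`
-- 2D+2 … 3D+1, `tripled` 3D+2 and `anchored` every length from 3D+3 on.  For f = 0 the lengths 4, 5
-- and 8 of `doubled` and `tripled` are exactly the exceptions.
module EvenDifference (f : ℕ) where

  c n : ℕ
  c = suc f
  n = suc (f + f)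

  P : ℕ → Set
  P = Anchored (suc n) (suc c)

  Q : ℕ → Set
  Q r = ¬ Exceptional (suc n) r → StartingWith (suc n) r

  ⌈n/2⌉≡c : ⌈ n /2⌉ ≡ c
  ⌈n/2⌉≡c = cong suc (sym (n≡⌊n+n/2⌋ f))

  ⌊n/2⌋≡f : ⌊ n /2⌋ ≡ f
  ⌊n/2⌋≡f = sym (n≡⌈n+n/2⌉ f)

  step : ∀ {L} → P L → P (L + suc (c + c))
  step = anchored-step-odd

  step′ : ∀ {L} → P L → P (L + suc (suc (c + c)))
  step′ {L} p = subst P (cong (λ k → L + suc k) (+-suc c c)) (anchored-step-even p)

  window : Window P (n + 2) n
  window i i<n = subst (λ m → Anchored (suc n) (suc m) (n + 2 + i)) ⌈n/2⌉≡c (seed-window n i e≤c)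
    where
      e≤c : suc ⌈ i /2⌉ ≤ ⌈ n /2⌉
      e≤c = ≤-trans (⌈n/2⌉-mono (s≤s i<n)) (≤-reflexive (cong suc (trans (sym (n≡⌈n+n/2⌉ f)) (n≡⌊n+n/2⌋ f))))

  layer : Window P (n + 2 + suc (c + c)) (suc n)
  layer = window-layer {P = P} step step′ window

  anchored : ∀ i → P (n + 2 + suc (c + c) + suc (c + c) + i)
  anchored = window-periodic {P = P} step (s≤s z≤n)
               (subst (Window P _) (cong (λ k → suc (suc k)) (sym (+-suc f f))) (window-layer {P = P} step step′ layer))

  beyond : 1 ≤ f → ∀ s → suc c ≡ s ⊎ suc c ≡ suc s → StartingWith (suc n) (n + suc (c + s))
  beyond 1≤f s halving = subst (λ k → StartingWith (suc n) (n + suc (k + s))) ⌈n/2⌉≡c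
    (forget-end (seed-window-beyond n s (subst (1 ≤_) (sym ⌊n/2⌋≡f) 1≤f) (subst (λ k → suc k ≡ s ⊎ suc k ≡ suc s) (sym ⌈n/2⌉≡c) halving)))

  doubled : 1 ≤ f → Window Q (n + 2 + n) 2
  doubled 1≤f zero          _ _ = subst (StartingWith (suc n)) (regroup₀ f) (beyond 1≤f c (inj₂ refl))
    where regroup₀ : ∀ f → suc (f + f) + suc (suc f + suc f) ≡ suc (f + f) + 2 + suc (f + f) + 0
          regroup₀ = solve-∀
  doubled 1≤f (suc zero)    _ _ = subst (StartingWith (suc n)) (regroup₁ f) (beyond 1≤f (suc c) (inj₁ refl))
    where regroup₁ : ∀ f → suc (f + f) + suc (suc f + suc (suc f)) ≡ suc (f + f) + 2 + suc (f + f) + 1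
          regroup₁ = solve-∀
  doubled 1≤f (suc (suc _)) (s≤s (s≤s ()))

  tripled : 1 ≤ f → f ≢ 2 → StartingWith (suc n) (n + 2 + n + 2 + suc n + 0)
  tripled 1≤f f≢2 with endingAtTwo f 1≤f f≢2
  ... | h , starts , ends = subst (StartingWith (suc n)) (regroup f)
    (forget-end (anchored-step-even (anchored-step-even (reversed , reversed-firstDiff (s≤s z≤n) , reversed-ends starts))))
    where
      open Extension h 1 1 (inj₂ refl) ends
      regroup : ∀ f → suc (f + f) + 3 + (suc f + suc f) + (suc f + suc f) ≡ suc (f + f) + 2 + suc (f + f) + 2 + suc (suc (f + f)) + 0
      regroup = solve-∀

  lengths : Window Q (n + 2 + n) 2 → Q (n + 2 + n + 2 + suc n + 0) → ∀ i → Q (n + 2 + i)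
  lengths short long =
    window-then {P = Q} (λ i i<n _ → forget-end (window i i<n))
    (window-then {P = Q} short
    (window-then {P = Q} (λ i i<n+1 _ → subst (StartingWith (suc n)) (cong (_+ i) (regroup₁ f)) (forget-end (layer i i<n+1)))
    (window-then {P = Q} (λ { zero _ → long ; (suc _) (s≤s ()) })
    (λ i _ → subst (StartingWith (suc n)) (regroup₂ f i) (forget-end (anchored i))))))
    where
      regroup₁ : ∀ f → suc (f + f) + 2 + suc (suc f + suc f) ≡ suc (f + f) + 2 + suc (f + f) + 2
      regroup₁ = solve-∀
      regroup₂ : ∀ f i → suc (f + f) + 2 + suc (suc f + suc f) + suc (suc f + suc f) + i
                       ≡ suc (f + f) + 2 + suc (f + f) + 2 + suc (suc (f + f)) + 1 + i
      regroup₂ = solve-∀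

even-lengths : ∀ f i → EvenDifference.Q f (EvenDifference.n f + 2 + i)
even-lengths zero = EvenDifference.lengths 0
  (λ { zero _ ¬exceptional → contradiction (inj₁ (refl , refl)) ¬exceptional
     ; (suc zero) _ ¬exceptional → contradiction (inj₂ (inj₁ (refl , refl))) ¬exceptional
     ; (suc (suc _)) (s≤s (s≤s ())) })
  (λ ¬exceptional → contradiction (inj₂ (inj₂ (refl , refl))) ¬exceptional)
even-lengths 1 = EvenDifference.lengths 1 (EvenDifference.doubled 1 ≤-refl) (λ _ → EvenDifference.tripled 1 ≤-refl (λ ()))
even-lengths 2 = EvenDifference.lengths 2 (EvenDifference.doubled 2 (s≤s z≤n)) (λ _ → six-twenty)
even-lengths f@(suc (suc (suc _))) =
  EvenDifference.lengths f (EvenDifference.doubled f (s≤s z≤n)) (λ _ → EvenDifference.tripled f (s≤s z≤n) (λ ()))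

startingWith′ : ∀ n i → ¬ Exceptional (suc n) (n + 2 + i) → StartingWith (suc n) (n + 2 + i)
startingWith′ n i with parity n
... | even zero     = λ _ → unit-lengths i
... | even (suc c′) = λ _ → OddDifference.lengths c′ i
... | odd  f        = even-lengths f i

startingWith : ∀ d r → 1 ≤ d → d < r → ¬ Exceptional d r → StartingWith d r
startingWith (suc n) r _ d<r =
  subst (λ r → ¬ Exceptional (suc n) r → StartingWith (suc n) r) (m+[n∸m]≡n n+2≤r) (startingWith′ n (r ∸ (n + 2)))
  where n+2≤r = subst (_≤ r) (+-comm 2 n) d<r

-- Graceful permutations

injective⇒surjective : ∀ {n} (f : Fin n → Fin n) → Injective _≡_ _≡_ f → ∀ j → ∃ λ i → f i ≡ j
injective⇒surjective {suc n} f f-injective j with any? (λ i → f i ≟ᶠ j)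
... | yes hit  = hit
... | no  miss = contradiction (injective⇒≤ punched-injective) 1+n≰n
  where
    punched : Fin (suc n) → Fin n
    punched i = punchOut (λ j≡fi → miss (i , sym j≡fi))
    punched-injective : Injective _≡_ _≡_ punched
    punched-injective {a} {b} =
      f-injective ∘′ punchOut-injective {i = j} (λ j≡fa → miss (a , sym j≡fa)) (λ j≡fb → miss (b , sym j≡fb))

module _ (xs : List ℕ) (in-range : All (InRange (length xs)) xs) (distinct : Unique xs) where

  private
    n = length xs

    entry-in-range : ∀ i → InRange n (lookup xs i)
    entry-in-range i = All.lookup in-range (∈-lookup i)

    pred<n : ∀ {x} → InRange n x → pred x < n
    pred<n (s≤s z≤n , x≤n) = x≤n

    suc-pred-entry : ∀ {x} → InRange n x → suc (pred x) ≡ x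
    suc-pred-entry (s≤s z≤n , _) = refl

    position : Fin n → Fin n
    position i = fromℕ< (pred<n (entry-in-range i))

    suc-position : ∀ i → suc (toℕ (position i)) ≡ lookup xs i
    suc-position i = trans (cong suc (toℕ-fromℕ< (pred<n (entry-in-range i)))) (suc-pred-entry (entry-in-range i))

    position-injective : Injective _≡_ _≡_ position
    position-injective {i} {j} eq =
      Unique-lookup-injective distinct (trans (sym (suc-position i)) (trans (cong (suc ∘′ toℕ) eq) (suc-position j)))

    position-surjective : ∀ j → ∃ λ i → position i ≡ j
    position-surjective = injective⇒surjective position position-injective

  listPermutation : Permutation′ n
  listPermutation = permutation position (λ j → proj₁ (position-surjective j)) (λ j → proj₂ (position-surjective j))
                                (λ i → position-injective (proj₂ (position-surjective (position i))))

  arrangement-listPermutation : arrangement listPermutation ≡ xs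
  arrangement-listPermutation = trans (map-tabulate (λ i → i) _) (trans (tabulate-cong suc-position) (tabulate-lookup xs))

toGracefulPermutation : ∀ {d r} → StartingWith d r → GracefulStartingWith d r
toGracefulPermutation {d} (g , first) =
  subst (GracefulStartingWith d) (length-elems g)
    ( listPermutation xs in-range (elems-distinct g)
    , subst (Unique ∘′ absDiffs) (sym arranged) (diffs-distinct g)
    , trans (cong (head ∘′ absDiffs) arranged) first )
  where
    xs = elems g
    in-range = subst (λ k → All (InRange k) xs) (sym (length-elems g)) (elems-in-range g)
    arranged = arrangement-listPermutation xs in-range (elems-distinct g)

module _ {r : ℕ} (π : Permutation′ r) where

  length-arrangement : length (arrangement π) ≡ r
  length-arrangement = trans (length-map _ (allFin r)) (length-tabulate (λ i → i))

  arrangement-⊆ : All (_∈ applyUpTo suc r) (arrangement π)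
  arrangement-⊆ = All.map⁺ (All.tabulate⁺ (λ i → ∈-applyUpTo⁺ suc (toℕ<n (π ⟨$⟩ʳ i))))

  arrangement-distinct : Unique (arrangement π)
  arrangement-distinct = Unique.map⁺ (Injection.injective (↔⇒↣ π) ∘′ toℕ-injective ∘′ suc-injective) (Unique.allFin⁺ r)

-- Exhaustive search

module Exhaustion {P : List ℕ → Set} (P? : Decidable P) (P-++⁻ˡ : ∀ xs ys → P (xs ++ ys) → P xs) (alphabet : List ℕ) where

  noCompletion : ℕ → List ℕ → Bool
  noCompletion zero    xs = isNo (P? xs)
  noCompletion (suc k) xs = isNo (P? xs) ∨ all (λ x → noCompletion k (xs ++ [ x ])) alphabet

  noCompletion-sound : ∀ k xs ys → T (noCompletion k xs) → length ys ≡ k → All (_∈ alphabet) ys → ¬ P (xs ++ ys)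
  noCompletion-sound zero    xs []       dead   refl []          p = toWitnessFalse dead (subst P (++-identityʳ xs) p)
  noCompletion-sound (suc k) xs (y ∷ ys) search refl (y∈ ∷ ys∈) p with Equivalence.to T-∨ search
  ... | inj₁ dead  = toWitnessFalse dead (P-++⁻ˡ xs (y ∷ ys) p)
  ... | inj₂ every = noCompletion-sound k (xs ++ [ y ]) ys (All.lookup (All.all⁺ _ _ every) y∈) refl ys∈
                                        (subst P (sym (++-assoc xs [ y ] ys)) p)

GracefulPrefix : ℕ → List ℕ → Set
GracefulPrefix d xs = Unique xs × Unique (absDiffs xs) × MaybeAll.All (_≡ d) (head (absDiffs xs))

gracefulPrefix? : ∀ d → Decidable (GracefulPrefix d)
gracefulPrefix? d xs = unique? xs ×-dec unique? (absDiffs xs) ×-dec MaybeAll.dec (_≟ d) (head (absDiffs xs))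

gracefulPrefix-++⁻ˡ : ∀ {d} xs ys → GracefulPrefix d (xs ++ ys) → GracefulPrefix d xs
gracefulPrefix-++⁻ˡ xs ys (distinct , graceful , first) with absDiffs-++-prefix xs ys
... | zs , diffs≡ =
  Unique-++⁻ˡ xs distinct ,
  Unique-++⁻ˡ (absDiffs xs) (subst Unique diffs≡ graceful) ,
  head-prefix (absDiffs xs) (subst (MaybeAll.All _ ∘′ head) diffs≡ first)
  where
    head-prefix : ∀ {P : ℕ → Set} (xs : List ℕ) {ys} → MaybeAll.All P (head (xs ++ ys)) → MaybeAll.All P (head xs)
    head-prefix []       _ = MaybeAll.nothing
    head-prefix (x ∷ xs) p = p

no-graceful-permutation : ∀ d r → T (Exhaustion.noCompletion (gracefulPrefix? d) gracefulPrefix-++⁻ˡ (applyUpTo suc r) r []) →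
                          ¬ GracefulStartingWith d r
no-graceful-permutation d r search (π , graceful , first) =
  Exhaustion.noCompletion-sound (gracefulPrefix? d) gracefulPrefix-++⁻ˡ (applyUpTo suc r) r [] (arrangement π) search
    (length-arrangement π) (arrangement-⊆ π)
    (arrangement-distinct π , graceful , subst (MaybeAll.All (_≡ d)) (sym first) (MaybeAll.just refl))

lemma4p5 : (d r : ℕ) → 1 ≤ d → d < r →
    GracefulStartingWith d r ⇔ (¬ Exceptional d r)
lemma4p5 d r 1≤d d<r = mk⇔ not-exceptional (toGracefulPermutation ∘′ startingWith d r 1≤d d<r)
  where
    not-exceptional : GracefulStartingWith d r → ¬ Exceptional d r
    not-exceptional graceful (inj₁ (refl , refl))        = no-graceful-permutation 2 4 _ graceful
    not-exceptional graceful (inj₂ (inj₁ (refl , refl))) = no-graceful-permutation 2 5 _ graceful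
    not-exceptional graceful (inj₂ (inj₂ (refl , refl))) = no-graceful-permutation 2 8 _ graceful
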